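{- Let $(X,\{R_i\}_{i=0}^d)$ be a symmetric association scheme with adjacency matrices $A_0=I,A_1,\dots,A_d$ and intersection numbers $p_{ij}^k$, and let $W=\sum_{i=0}^dw_iA_i$ be a complex Hadamard matrix with $w_0=1$. Let $\Delta\subseteq\{1,\dots,d\}$ and suppose there exists $i\in\{1,\dots,d\}$ such that $p_{i_1,j_1}^i>0$ for all $i_1,j_1\in\Delta$. Then \[H_4(W)\supseteq\left\{\frac{w_{i_1}w_{i_2}}{w_{j_1}w_{j_2}}\ \Big|\ i_1,i_2,j_1,j_2\in\Delta\right\}\setminus\{1\}.\] In particular, if there exists $i\in\{1,\dots,d\}$ with $p_{i_1,j_1}^i>0$ for all $i_1,j_1\in\{1,\dots,d\}$, then \[H_4(W)\setminus\{1\}=\left\{\frac{w_{i_1}w_{i_2}}{w_{j_1}w_{j_2}}\ \Big|\ i_1,i_2,j_1,j_2\in\{1,\dots,d\}\right\}\setminus\{1\}.\]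
   Context: For $(x,y)\in R_k$, $p_{ij}^k=|\{z\in X:(x,z)\in R_i,(z,y)\in R_j\}|$. A complex Hadamard matrix of order $n$ is a square matrix with entries of absolute value $1$ and $HH^\ast=nI$. $H_4(W)=\left\{\frac{W_{x_1,y_1}W_{x_2,y_2}}{W_{x_2,y_1}W_{x_1,y_2}}: x_1,x_2,y_1,y_2\in X \text{ pairwise distinct}\right\}$. -}

module Defs where

open import Level using (Level; _⊔_)
open import Data.Nat using (ℕ; zero; suc; _>_)
open import Data.Fin as Fin using ()
open import Data.Fin using (Fin)
open import Data.Fin.Properties using (_≟_)
open import Data.List using (List; length; filter)
open import Data.List using () renaming (allFin to allFinL)
open import Data.Product using (Σ; _×_; _,_; ∃)
open import Relation.Nullary using (¬_)
open import Relation.Nullary.Decidable using (_×-dec_)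
open import Relation.Binary.PropositionalEquality using (_≡_; _≢_)
open import Algebra.Bundles using (CommutativeRing)

-- The scheme is given by the "class map" R : X → X → Fin (suc d),
-- (x,y) ∈ R_i  iff  R x y ≡ i.  This encodes that {R_i} partitions X×X.

pcount : ∀ {n d} → (Fin n → Fin n → Fin (ℕ.suc d)) →
         Fin n → Fin n → Fin (ℕ.suc d) → Fin (ℕ.suc d) → ℕ
pcount {n} R x y i j =
  length (filter (λ z → (R x z ≟ i) ×-dec (R z y ≟ j)) (allFinL n))

record SymmetricAssociationScheme (n d : ℕ) : Set where
  field
    R          : Fin n → Fin n → Fin (ℕ.suc d)
    R0-diag    : ∀ x y → R x y ≡ Fin.zero → x ≡ y
    R0-refl    : ∀ x → R x x ≡ Fin.zero
    nonempty   : ∀ i → Σ (Fin n) λ x → Σ (Fin n) λ y → R x y ≡ i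
    symmetric  : ∀ x y → R x y ≡ R y x
    -- intersection numbers p_{ij}^k are well defined
    regular    : ∀ x y x′ y′ → R x y ≡ R x′ y′ →
                 ∀ i j → pcount R x y i j ≡ pcount R x′ y′ i j

  -- p_{ij}^k > 0, expressed at every/any (x,y) ∈ R_k (well-defined by `regular`)
  p>0 : Fin (ℕ.suc d) → Fin (ℕ.suc d) → Fin (ℕ.suc d) → Set
  p>0 i j k = ∀ x y → R x y ≡ k → pcount R x y i j > 0

-- Abstract stand-in for ℂ: a field with complex conjugation.
-- (Agda's standard library has no complex numbers.)

record ConjugationField (c ℓ : Level) : Set (Level.suc (c ⊔ ℓ)) where
  field
    commutativeRing : CommutativeRing c ℓ
  open CommutativeRing commutativeRing public hiding (zero)
  field
    _⁻¹      : Carrier → Carrier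
    inverseʳ : ∀ x → ¬ (x ≈ 0#) → x * (x ⁻¹) ≈ 1#
    0≉1      : ¬ (0# ≈ 1#)
    conj     : Carrier → Carrier
    conj-cong : ∀ {x y} → x ≈ y → conj x ≈ conj y
    conj-+   : ∀ x y → conj (x + y) ≈ conj x + conj y
    conj-*   : ∀ x y → conj (x * y) ≈ conj x * conj y
    conj-1   : conj 1# ≈ 1#
    conj-invol : ∀ x → conj (conj x) ≈ x

  _/_ : Carrier → Carrier → Carrier
  x / y = x * (y ⁻¹)

  fromℕ : ℕ → Carrier
  fromℕ zero = 0#
  fromℕ (suc m) = 1# + fromℕ m

  Σ[_] : ∀ {n} → (Fin n → Carrier) → Carrier
  Σ[_] {zero} f = 0#
  Σ[_] {suc n} f = f Fin.zero + Σ[ (λ i → f (Fin.suc i)) ]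

  Unimodular : Carrier → Set ℓ
  Unimodular a = a * conj a ≈ 1#

  IsComplexHadamard : ∀ n → (Fin n → Fin n → Carrier) → Set ℓ
  IsComplexHadamard n H =
    (∀ x y → Unimodular (H x y)) ×
    (∀ x → Σ[ (λ z → H x z * conj (H x z)) ] ≈ fromℕ n) ×
    (∀ x y → x ≢ y → Σ[ (λ z → H x z * conj (H y z)) ] ≈ 0#)

  _∈H₄_ : ∀ {n} → Carrier → (Fin n → Fin n → Carrier) → Set ℓ
  _∈H₄_ {n} a W =
    Σ (Fin n) λ x₁ → Σ (Fin n) λ x₂ → Σ (Fin n) λ y₁ → Σ (Fin n) λ y₂ →
      (x₁ ≢ x₂) × (x₁ ≢ y₁) × (x₁ ≢ y₂) × (x₂ ≢ y₁) × (x₂ ≢ y₂) × (y₁ ≢ y₂) ×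
      (a ≈ (W x₁ y₁ * W x₂ y₂) / (W x₂ y₁ * W x₁ y₂))

  -- the matrix W = Σ_i w_i A_i
  schemeMatrix : ∀ {n d} → SymmetricAssociationScheme n d →
                 (Fin (ℕ.suc d) → Carrier) → Fin n → Fin n → Carrier
  schemeMatrix S w x y = w (SymmetricAssociationScheme.R S x y)

module Submission where

-- Let i₁,i₂,j₁,j₂ be nonzero classes and pick (x,y) ∈ R_i.  If
-- p^i_{i₁ j₁} > 0 and p^i_{j₂ i₂} > 0 there are points z, z′ with
--   (x,z) ∈ R_{i₁}, (z,y) ∈ R_{j₁},   (x,z′) ∈ R_{j₂}, (z′,y) ∈ R_{i₂},
-- and by symmetry of the scheme the quadruple (x₁,x₂,y₁,y₂) = (x,y,z,z′)
-- has cross ratio  W_{xz} W_{yz′} / (W_{yz} W_{xz′}) = w_{i₁}w_{i₂}/(w_{j₁}w_{j₂}).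
-- The six points are pairwise distinct: nonzero classes separate x, y from
-- z, z′, and z = z′ would force i₁ = j₂, i₂ = j₁, i.e. the ratio would be 1.
-- Conversely every element of H₄(W) is such a ratio, since the four entries
-- of W involved sit off the diagonal.

open import Defs
open import Data.Nat using (ℕ; _>_)
open import Data.Fin using (Fin; zero; suc)
open import Data.Fin.Properties using (_≟_)
open import Data.List using (List; _∷_; length; filter)
open import Data.List using () renaming (allFin to allFinL)
open import Data.List.Membership.Propositional using (_∈_)
open import Data.List.Membership.Propositional.Properties using (∈-filter⁻)
open import Data.List.Relation.Unary.Any using (here)
open import Data.Product using (Σ; _×_; _,_; proj₂)
open import Data.Unit using (⊤; tt)
open import Data.Empty using (⊥-elim)
open import Function.Bundles using (_⇔_; mk⇔)
open import Relation.Nullary using (¬_)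
open import Relation.Nullary.Decidable using (_×-dec_)
open import Relation.Unary using (Decidable)
open import Relation.Binary.PropositionalEquality as P using (_≡_; _≢_)
import Algebra.Properties.CommutativeSemigroup as CommutativeSemigroupProperties
import Relation.Binary.Reasoning.Setoid as SetoidReasoning

-- A filtered list of positive length contains an element satisfying the
-- filter predicate; this turns "p^k_{ij} > 0" into an actual point z.
filter-witness : ∀ {a p} {A : Set a} {P : A → Set p} (P? : Decidable P)
                 (xs : List A) → length (filter P? xs) > 0 → Σ A P
filter-witness P? xs nonzero-length with filter P? xs in filtered
... | z ∷ _ =
  z , proj₂ (∈-filter⁻ P? {xs = xs} (P.subst (z ∈_) (P.sym filtered) (here P.refl)))

module FieldFacts {c ℓ} (K : ConjugationField c ℓ) where
  open ConjugationField K
  open SetoidReasoning setoid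
  open CommutativeSemigroupProperties *-commutativeSemigroup using (interchange)

  unimodular-product-nonzero : ∀ {a b} → Unimodular a → Unimodular b → ¬ (a * b ≈ 0#)
  unimodular-product-nonzero {a} {b} ua ub ab≈0 = 0≉1 (sym 1≈0)
    where
    1≈0 : 1# ≈ 0#
    1≈0 = begin
      1#                          ≈⟨ sym (*-identityˡ 1#) ⟩
      1# * 1#                     ≈⟨ *-cong (sym ua) (sym ub) ⟩
      (a * conj a) * (b * conj b) ≈⟨ interchange a (conj a) b (conj b) ⟩
      (a * b) * (conj a * conj b) ≈⟨ *-congʳ ab≈0 ⟩
      0# * (conj a * conj b)      ≈⟨ zeroˡ _ ⟩
      0#                          ∎

  swapped-ratio≈1 : ∀ {a b} → Unimodular a → Unimodular b → (a * b) / (b * a) ≈ 1#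
  swapped-ratio≈1 {a} {b} ua ub = begin
    (a * b) / (b * a) ≈⟨ *-congʳ (*-comm a b) ⟩
    (b * a) / (b * a) ≈⟨ inverseʳ (b * a) (unimodular-product-nonzero ub ua) ⟩
    1#                ∎

  ∈H₄-resp-≈ : ∀ {n} {W : Fin n → Fin n → Carrier} {a b} → a ≈ b → b ∈H₄ W → a ∈H₄ W
  ∈H₄-resp-≈ a≈b (x₁ , x₂ , y₁ , y₂ , d₁ , d₂ , d₃ , d₄ , d₅ , d₆ , b≈ratio) =
    x₁ , x₂ , y₁ , y₂ , d₁ , d₂ , d₃ , d₄ , d₅ , d₆ , trans a≈b b≈ratio

module SchemeFacts {n d} (S : SymmetricAssociationScheme n d) where
  open SymmetricAssociationScheme S

  nonzero-class⇒distinct : ∀ {x y k} → R x y ≡ suc k → x ≢ y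
  nonzero-class⇒distinct {x} Rxy≡suc P.refl with P.trans (P.sym (R0-refl x)) Rxy≡suc
  ... | ()

  distinct⇒nonzero-class : ∀ {x y} → x ≢ y → Σ (Fin d) λ k → R x y ≡ suc k
  distinct⇒nonzero-class {x} {y} x≢y with R x y in Rxy
  ... | zero  = ⊥-elim (x≢y (R0-diag x y Rxy))
  ... | suc k = k , P.refl

  intersection-witness : ∀ {i j k} → p>0 i j k → ∀ {x y} → R x y ≡ k →
                         Σ (Fin n) λ z → (R x z ≡ i) × (R z y ≡ j)
  intersection-witness {i} {j} p>0ᵢⱼᵏ {x} {y} Rxy≡k =
    filter-witness (λ z → (R x z ≟ i) ×-dec (R z y ≟ j)) (allFinL n) (p>0ᵢⱼᵏ x y Rxy≡k)

  -- The entries of a Hadamard matrix W = Σ wᵢAᵢ are unimodular, so every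
  -- weight wₖ is (each class Rₖ is nonempty).
  hadamard-weights-unimodular : ∀ {c ℓ} (K : ConjugationField c ℓ)
    (w : Fin (ℕ.suc d) → ConjugationField.Carrier K) →
    ConjugationField.IsComplexHadamard K n (ConjugationField.schemeMatrix K S w) →
    ∀ k → ConjugationField.Unimodular K (w k)
  hadamard-weights-unimodular K w (entries-unimodular , _) k with nonempty k
  ... | x , y , P.refl = entries-unimodular x y

module Realisation {c ℓ} (K : ConjugationField c ℓ) {n d}
    (S : SymmetricAssociationScheme n d)
    (w : Fin (ℕ.suc d) → ConjugationField.Carrier K)
    (w-unimodular : ∀ k → ConjugationField.Unimodular K (w k)) where
  open ConjugationField K
  open SymmetricAssociationScheme S
  open SchemeFacts S
  open FieldFacts K

  W : Fin n → Fin n → Carrier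
  W = schemeMatrix S w

  ratio : (i₁ i₂ j₁ j₂ : Fin (ℕ.suc d)) → Carrier
  ratio i₁ i₂ j₁ j₂ = (w i₁ * w i₂) / (w j₁ * w j₂)

  matched-ratio≈1 : ∀ {i₁ i₂ j₁ j₂} → i₁ ≡ j₂ → i₂ ≡ j₁ → ratio i₁ i₂ j₁ j₂ ≈ 1#
  matched-ratio≈1 {i₁} {i₂} P.refl P.refl =
    swapped-ratio≈1 (w-unimodular i₁) (w-unimodular i₂)

  path-pair-realises : ∀ {x y z z′ i₁ i₂ j₁ j₂} → x ≢ y →
    R x z ≡ suc i₁ → R z y ≡ suc j₁ → R x z′ ≡ suc j₂ → R z′ y ≡ suc i₂ →
    ¬ (ratio (suc i₁) (suc i₂) (suc j₁) (suc j₂) ≈ 1#) →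
    ratio (suc i₁) (suc i₂) (suc j₁) (suc j₂) ∈H₄ W
  path-pair-realises {x} {y} {z} {z′} {i₁} {i₂} {j₁} {j₂} x≢y Rxz Rzy Rxz′ Rz′y nontrivial =
    x , y , z , z′ ,
    x≢y , nonzero-class⇒distinct Rxz , nonzero-class⇒distinct Rxz′ ,
    nonzero-class⇒distinct Ryz , nonzero-class⇒distinct Ryz′ , z≢z′ ,
    reflexive (P.cong₂ _/_
      (P.cong₂ _*_ (P.cong w (P.sym Rxz)) (P.cong w (P.sym Ryz′)))
      (P.cong₂ _*_ (P.cong w (P.sym Ryz)) (P.cong w (P.sym Rxz′))))
    where
    Ryz : R y z ≡ suc j₁
    Ryz = P.trans (symmetric y z) Rzy
    Ryz′ : R y z′ ≡ suc i₂
    Ryz′ = P.trans (symmetric y z′) Rz′y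
    z≢z′ : z ≢ z′
    z≢z′ P.refl = nontrivial (matched-ratio≈1 (P.trans (P.sym Rxz) Rxz′)
                                               (P.trans (P.sym Rz′y) Rzy))

  ratios-in-H₄ : (Δ : Fin d → Set) →
    Σ (Fin d) (λ i → ∀ i₁ j₁ → Δ i₁ → Δ j₁ → p>0 (suc i₁) (suc j₁) (suc i)) →
    ∀ i₁ i₂ j₁ j₂ → Δ i₁ → Δ i₂ → Δ j₁ → Δ j₂ →
    ¬ (ratio (suc i₁) (suc i₂) (suc j₁) (suc j₂) ≈ 1#) →
    ratio (suc i₁) (suc i₂) (suc j₁) (suc j₂) ∈H₄ W
  ratios-in-H₄ Δ (i , p>0ᵢ) i₁ i₂ j₁ j₂ i₁∈Δ i₂∈Δ j₁∈Δ j₂∈Δ nontrivial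
    with nonempty (suc i)
  ... | x , y , Rxy
    with intersection-witness (p>0ᵢ i₁ j₁ i₁∈Δ j₁∈Δ) Rxy
       | intersection-witness (p>0ᵢ j₂ i₂ j₂∈Δ i₂∈Δ) Rxy
  ... | z , Rxz , Rzy | z′ , Rxz′ , Rz′y =
    path-pair-realises (nonzero-class⇒distinct Rxy) Rxz Rzy Rxz′ Rz′y nontrivial

  -- Every element of H₄(W) is a ratio of weights of nonzero classes,
  -- because the four entries of a cross ratio lie off the diagonal.
  H₄-elements-are-ratios : ∀ {a} → a ∈H₄ W →
    Σ (Fin d) λ i₁ → Σ (Fin d) λ i₂ → Σ (Fin d) λ j₁ → Σ (Fin d) λ j₂ →
      a ≈ ratio (suc i₁) (suc i₂) (suc j₁) (suc j₂)
  H₄-elements-are-ratios (x₁ , x₂ , y₁ , y₂ , _ , x₁≢y₁ , x₁≢y₂ , x₂≢y₁ , x₂≢y₂ , _ , a≈)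
    with distinct⇒nonzero-class x₁≢y₁ | distinct⇒nonzero-class x₂≢y₂
       | distinct⇒nonzero-class x₂≢y₁ | distinct⇒nonzero-class x₁≢y₂
  ... | i₁ , R₁₁ | i₂ , R₂₂ | j₁ , R₂₁ | j₂ , R₁₂ =
    i₁ , i₂ , j₁ , j₂ , trans a≈ (reflexive (P.cong₂ _/_
      (P.cong₂ _*_ (P.cong w R₁₁) (P.cong w R₂₂))
      (P.cong₂ _*_ (P.cong w R₂₁) (P.cong w R₁₂))))

  -- Second claim: if one class i works for all of {1,…,d}, then off 1 the
  -- set H₄(W) is exactly the set of ratios (take Δ = {1,…,d} above).
  H₄-off-1≡ratios-off-1 :
    Σ (Fin d) (λ i → ∀ i₁ j₁ → p>0 (suc i₁) (suc j₁) (suc i)) → ∀ a →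
    ((a ∈H₄ W) × ¬ (a ≈ 1#)) ⇔
    (Σ (Fin d) (λ i₁ → Σ (Fin d) λ i₂ → Σ (Fin d) λ j₁ → Σ (Fin d) λ j₂ →
       a ≈ ratio (suc i₁) (suc i₂) (suc j₁) (suc j₂)) × ¬ (a ≈ 1#))
  H₄-off-1≡ratios-off-1 (i , p>0ᵢ) a = mk⇔
    (λ (a∈H₄ , a≉1) → H₄-elements-are-ratios a∈H₄ , a≉1)
    (λ ((i₁ , i₂ , j₁ , j₂ , a≈ratio) , a≉1) →
      ∈H₄-resp-≈ a≈ratio
        (ratios-in-H₄ (λ _ → ⊤) (i , λ i₁′ j₁′ _ _ → p>0ᵢ i₁′ j₁′)
          i₁ i₂ j₁ j₂ tt tt tt tt (λ ratio≈1 → a≉1 (trans a≈ratio ratio≈1)))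
      , a≉1)

lemma5p2 : ∀ {c ℓ} (K : ConjugationField c ℓ) (n d : ℕ)
      (S : SymmetricAssociationScheme n d)
      (w : Fin (ℕ.suc d) → ConjugationField.Carrier K) →
      ConjugationField._≈_ K (w zero) (ConjugationField.1# K) →
      ConjugationField.IsComplexHadamard K n (ConjugationField.schemeMatrix K S w) →
      -- first claim: for Δ ⊆ {1,…,d} (indexed via suc)
      ((Δ : Fin d → Set) →
        Σ (Fin d) (λ i → ∀ i₁ j₁ → Δ i₁ → Δ j₁ →
            SymmetricAssociationScheme.p>0 S (suc i₁) (suc j₁) (suc i)) →
        ∀ i₁ i₂ j₁ j₂ → Δ i₁ → Δ i₂ → Δ j₁ → Δ j₂ →
          let open ConjugationField K
              a = (w (suc i₁) * w (suc i₂)) / (w (suc j₁) * w (suc j₂))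
          in ¬ (a ≈ 1#) → a ∈H₄ schemeMatrix S w)
      ×
      -- second claim ("in particular")
      (Σ (Fin d) (λ i → ∀ i₁ j₁ →
            SymmetricAssociationScheme.p>0 S (suc i₁) (suc j₁) (suc i)) →
        ∀ a → let open ConjugationField K in
          ((a ∈H₄ schemeMatrix S w) × ¬ (a ≈ 1#)) ⇔
          (Σ (Fin d) (λ i₁ → Σ (Fin d) λ i₂ → Σ (Fin d) λ j₁ → Σ (Fin d) λ j₂ →
             a ≈ (w (suc i₁) * w (suc i₂)) / (w (suc j₁) * w (suc j₂))) × ¬ (a ≈ 1#)))
lemma5p2 K n d S w _ hadamard = ratios-in-H₄ , H₄-off-1≡ratios-off-1
  where open Realisation K S w (SchemeFacts.hadamard-weights-unimodular S K w hadamard)
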